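{- Let $G=(V,E,L)$ be a $\Sigma$-labeled directed graph with no infinite repeated string. Then $G$ has repeated strings of unbounded length if and only if there are $R,S\in\Sigma^+$ such that $R^mS$ is a repeated string in $G$ for every $m\ge1$.
   Context: A $\Sigma$-labeled graph is $G=(V,E,L)$, $(V,E)$ a finite directed graph, $L\colon V\to\Sigma$. A walk is a finite or infinite sequence of vertices with consecutive vertices joined by edges; its spelling is the sequence of labels. Two walks $(p_i),(q_i)$ are distinct if $p_i\ne q_i$ for some $i$; a (finite or infinite) string is repeated in $G$ if it is spelled by two distinct walks. $G$ has repeated strings of unbounded length if for every $n\in\mathbb{N}$ there is a finite repeated string of length greater than $n$. $\Sigma^+$ denotes nonempty finite strings. -}

module Defs where

open import Data.Nat using (ℕ; suc; _<_)
open import Data.Fin using (Fin)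
open import Data.Bool using (Bool; true)
open import Data.List using (List; []; _∷_; map; length; _++_; concat; replicate)
open import Data.Product using (Σ; ∃; ∃-syntax; _×_)
open import Relation.Binary.PropositionalEquality using (_≡_; _≢_)
open import Relation.Nullary using (¬_)

record LabeledGraph (A : Set) : Set where
  field
    size  : ℕ
    edge  : Fin size → Fin size → Bool
    label : Fin size → A

module _ {A : Set} (G : LabeledGraph A) where
  open LabeledGraph G

  V : Set
  V = Fin size

  data IsWalk : List V → Set where
    []  : IsWalk []
    [_] : (v : V) → IsWalk (v ∷ [])
    _∷_ : ∀ {u v vs} → edge u v ≡ true → IsWalk (v ∷ vs) → IsWalk (u ∷ v ∷ vs)

  spell : List V → List A
  spell = map label

  Repeated : List A → Set
  Repeated s = Σ (List V) λ p → Σ (List V) λ q →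
    IsWalk p × IsWalk q × spell p ≡ s × spell q ≡ s × p ≢ q

  IsInfWalk : (ℕ → V) → Set
  IsInfWalk p = ∀ i → edge (p i) (p (suc i)) ≡ true

  InfRepeated : (ℕ → A) → Set
  InfRepeated s = Σ (ℕ → V) λ p → Σ (ℕ → V) λ q →
    IsInfWalk p × IsInfWalk q × (∀ i → label (p i) ≡ s i) × (∀ i → label (q i) ≡ s i)
      × ∃[ i ] p i ≢ q i

  NoInfRepeated : Set
  NoInfRepeated = ∀ (s : ℕ → A) → ¬ InfRepeated s

  UnboundedRepeated : Set
  UnboundedRepeated = ∀ (n : ℕ) → ∃[ s ] (n < length s × Repeated s)

_^^_ : {A : Set} → List A → ℕ → List A
R ^^ m = concat (replicate m R)

-- Two walks spelling the same word are one walk in the product graph G × G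
-- restricted to pairs of equally labelled vertices, and they differ exactly
-- when this walk visits an off-diagonal pair.  A repeated word longer than
-- the number of vertex pairs makes the product walk revisit a pair, which
-- splits it as a prefix, a loop and a suffix.  If an off-diagonal pair lies
-- in the prefix, running around the loop forever gives an infinite repeated
-- string; otherwise one lies in the loop or after it, and pumping the loop
-- gives the repeated words R^m S.
module Submission where

open import Defs
open import Level using (Level)
open import Data.Nat using (ℕ; zero; suc; _+_; _*_; _≥_; _≤_; _<_; s≤s; z≤n)
open import Data.Nat.Properties using (m≤m*n; m≤m+n; ≤-trans)
open import Data.Fin using (Fin; zero; suc; combine; remQuot)
  renaming (_<_ to _<ᶠ_)
open import Data.Fin.Properties using (pigeonhole; remQuot-combine; _≟_)
open import Data.List using (List; []; _∷_; _++_; map; length; concat; replicate; lookup; zip; head)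
open import Data.List.Properties using (++-assoc; map-++; map-∘; map-cong-local; length-++; length-map; concat-map; map-replicate; ∷-injective)
open import Data.List.Membership.Propositional.Properties using (∈-∃++; ∈-lookup)
open import Data.List.Relation.Unary.All using (All; []; _∷_)
import Data.List.Relation.Unary.All.Properties as All
open import Data.List.Relation.Unary.Any using (Any; here; there)
import Data.List.Relation.Unary.Any.Properties as Any
open import Data.List.Relation.Unary.Linked as Linked using (Linked; []; [-]; _∷_)
import Data.List.Relation.Unary.Linked.Properties as Linked
open import Data.List.Relation.Binary.Pointwise as Pointwise using (Pointwise; []; _∷_; ≡⇒Pointwise-≡)
open import Data.Maybe using (just)
open import Data.Product using (Σ; ∃-syntax; _×_; _,_; proj₁; proj₂; uncurry)
open import Data.Sum using (inj₁; inj₂)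
open import Data.Empty using (⊥-elim)
open import Data.Bool using (true)
open import Function.Base using (_on_)
open import Function.Bundles using (_⇔_; mk⇔)
open import Function.Definitions using (Injective)
open import Relation.Binary.Core using (Rel; REL)
open import Relation.Binary.Definitions using (DecidableEquality)
open import Relation.Binary.Construct.Intersection using (_∩_)
open import Relation.Binary.PropositionalEquality
open import Relation.Nullary using (yes; no)
open import Relation.Unary using (Pred)

private
  variable
    ℓ ℓ′ : Level
    B C : Set

module _ {R : Rel B ℓ} where

  Linked-++⁻ˡ : ∀ xs {ys} → Linked R (xs ++ ys) → Linked R xs
  Linked-++⁻ˡ []           _       = []
  Linked-++⁻ˡ (x ∷ [])     _       = [-]
  Linked-++⁻ˡ (x ∷ y ∷ xs) (r ∷ l) = r ∷ Linked-++⁻ˡ (y ∷ xs) l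

  Linked-++⁻ʳ : ∀ xs {ys} → Linked R (xs ++ ys) → Linked R ys
  Linked-++⁻ʳ []       l = l
  Linked-++⁻ʳ (x ∷ xs) l = Linked-++⁻ʳ xs (Linked.tail l)

  Linked-replaceSuffix : ∀ xs {y ys zs} → head zs ≡ just y →
    Linked R (xs ++ y ∷ ys) → Linked R zs → Linked R (xs ++ zs)
  Linked-replaceSuffix []           _    _       l′ = l′
  Linked-replaceSuffix (x ∷ [])     {zs = _ ∷ _} refl (r ∷ _) l′ = r ∷ l′
  Linked-replaceSuffix (x ∷ y ∷ xs) eq   (r ∷ l) l′ = r ∷ Linked-replaceSuffix (y ∷ xs) eq l l′

-- Pumping works because the loop and the suffix both start at y.
module _ {y : B} {d e : List B} where

  head-^^-++ : ∀ m → head (((y ∷ d) ^^ m) ++ y ∷ e) ≡ just y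
  head-^^-++ zero    = refl
  head-^^-++ (suc m) = refl

  Linked-^^-++ : {R : Rel B ℓ} → Linked R (y ∷ d ++ y ∷ e) →
    ∀ m → Linked R (((y ∷ d) ^^ m) ++ y ∷ e)
  Linked-^^-++ l zero    = Linked-++⁻ʳ (y ∷ d) l
  Linked-^^-++ l (suc m) =
    subst (Linked _) (sym (++-assoc (y ∷ d) ((y ∷ d) ^^ m) (y ∷ e)))
      (Linked-replaceSuffix (y ∷ d) (head-^^-++ m) l (Linked-^^-++ l m))

All-^^-++ : ∀ {P : Pred B ℓ} xs {ys} → All P (xs ++ ys) → ∀ m → All P ((xs ^^ m) ++ ys)
All-^^-++ xs ps m = All.++⁺ (All.concat⁺ (All.replicate⁺ m (All.++⁻ˡ xs ps))) (All.++⁻ʳ xs ps)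

Any-^^-++ : ∀ {P : Pred B ℓ} xs {ys} → Any P (xs ++ ys) → ∀ m → Any P ((xs ^^ suc m) ++ ys)
Any-^^-++ xs p m with Any.++⁻ xs p
... | inj₁ inXs = Any.++⁺ˡ (Any.++⁺ˡ inXs)
... | inj₂ inYs = Any.++⁺ʳ (xs ^^ suc m) inYs

map-^^-++ : ∀ (f : B → C) xs m ys → map f ((xs ^^ m) ++ ys) ≡ (map f xs ^^ m) ++ map f ys
map-^^-++ f xs m ys = begin
  map f ((xs ^^ m) ++ ys)                     ≡⟨ map-++ f (xs ^^ m) ys ⟩
  map f (concat (replicate m xs)) ++ map f ys ≡⟨ cong (_++ map f ys) (concat-map (replicate m xs)) ⟨
  concat (map (map f) (replicate m xs)) ++ map f ys
    ≡⟨ cong (λ xss → concat xss ++ map f ys) (map-replicate (map f) m xs) ⟩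
  (map f xs ^^ m) ++ map f ys                 ∎
  where open ≡-Reasoning

length-^^ : ∀ (xs : List B) m → length (xs ^^ m) ≡ m * length xs
length-^^ xs zero    = refl
length-^^ xs (suc m) = trans (length-++ xs) (cong (length xs +_) (length-^^ xs m))

≤-length-^^ : ∀ {xs : List B} m → xs ≢ [] → m ≤ length (xs ^^ m)
≤-length-^^ {xs = []}     m xs≢[] = ⊥-elim (xs≢[] refl)
≤-length-^^ {xs = x ∷ xs} m _     =
  subst (m ≤_) (sym (length-^^ (x ∷ xs) m)) (m≤m*n m (suc (length xs)))

split-lookup₂ : ∀ (xs : List B) {i j} → i <ᶠ j →
  ∃[ c ] ∃[ d ] ∃[ e ] xs ≡ c ++ lookup xs i ∷ d ++ lookup xs j ∷ e
split-lookup₂ (x ∷ xs) {zero} {suc j} _ with ∈-∃++ (∈-lookup {xs = xs} j)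
... | d , e , eq = [] , d , e , cong (x ∷_) eq
split-lookup₂ (x ∷ xs) {suc i} {suc j} (s≤s i<j) with split-lookup₂ xs i<j
... | c , d , e , eq = x ∷ c , d , e , cong (x ∷_) eq

pigeonhole-split : ∀ {n} {f : B → Fin n} → Injective _≡_ _≡_ f → ∀ {xs} → n < length xs →
  ∃[ c ] ∃[ y ] ∃[ d ] ∃[ e ] xs ≡ c ++ y ∷ d ++ y ∷ e
pigeonhole-split {f = f} f-inj {xs} n<∣xs∣ with pigeonhole n<∣xs∣ (λ i → f (lookup xs i))
... | i , j , i<j , fi≡fj with split-lookup₂ xs i<j
... | c , d , e , eq rewrite f-inj fi≡fj = c , lookup xs j , d , e , eq

combine-injective : ∀ {m n} → Injective _≡_ _≡_ (uncurry (combine {m} {n}))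
combine-injective {n = n} {i₁ , j₁} {i₂ , j₂} eq = begin
  (i₁ , j₁)                 ≡⟨ remQuot-combine i₁ j₁ ⟨
  remQuot n (combine i₁ j₁) ≡⟨ cong (remQuot n) eq ⟩
  remQuot n (combine i₂ j₂) ≡⟨ remQuot-combine i₂ j₂ ⟩
  (i₂ , j₂)                 ∎
  where open ≡-Reasoning

module _ {R : REL B C ℓ} where

  map-proj₁-zip : ∀ {xs ys} → Pointwise R xs ys → map proj₁ (zip xs ys) ≡ xs
  map-proj₁-zip []       = refl
  map-proj₁-zip (_ ∷ rs) = cong (_ ∷_) (map-proj₁-zip rs)

  All-zip : ∀ {xs ys} → Pointwise R xs ys → All (uncurry R) (zip xs ys)
  All-zip []       = []
  All-zip (r ∷ rs) = r ∷ All-zip rs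

  Linked-zip : ∀ {S : Rel B ℓ′} {T : Rel C ℓ′} {xs ys} → Pointwise R xs ys →
    Linked S xs → Linked T ys → Linked ((S on proj₁) ∩ (T on proj₂)) (zip xs ys)
  Linked-zip []           []      []      = []
  Linked-zip (_ ∷ [])     [-]     [-]     = [-]
  Linked-zip (_ ∷ r ∷ rs) (s ∷ l) (t ∷ l′) = (s , t) ∷ Linked-zip (r ∷ rs) l l′

Any-zip-≢ : {R : Rel B ℓ} → DecidableEquality B → ∀ {xs ys} → xs ≢ ys →
  Pointwise R xs ys → Any (uncurry _≢_) (zip xs ys)
Any-zip-≢ _≟_ xs≢ys [] = ⊥-elim (xs≢ys refl)
Any-zip-≢ _≟_ {x ∷ _} {y ∷ _} xs≢ys (_ ∷ rs) with x ≟ y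
... | no x≢y    = here x≢y
... | yes refl = there (Any-zip-≢ _≟_ (λ eq → xs≢ys (cong (x ∷_) eq)) rs)

Any-≢⇒map-≢ : ∀ {f g : B → C} {xs} → Any (λ x → f x ≢ g x) xs → map f xs ≢ map g xs
Any-≢⇒map-≢ (here fx≢gx) eq = fx≢gx (proj₁ (∷-injective eq))
Any-≢⇒map-≢ (there p)    eq = Any-≢⇒map-≢ p (proj₂ (∷-injective eq))

-- The stream y, d, y, d, ..., produced by rotating the loop one step at a time.
cycle : B → List B → ℕ → B
cycle y d       zero    = y
cycle y []      (suc i) = cycle y [] i
cycle y (z ∷ d) (suc i) = cycle z (d ++ y ∷ []) i

prepend : List B → (ℕ → B) → ℕ → B
prepend []       s i       = s i
prepend (x ∷ xs) s zero    = x
prepend (x ∷ xs) s (suc i) = prepend xs s i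

lasso : List B → B → List B → ℕ → B
lasso c y d = prepend c (cycle y d)

module _ {R : Rel B ℓ} where

  cycle-Linked : ∀ {y} d → Linked R (y ∷ d ++ y ∷ []) → ∀ i → R (cycle y d i) (cycle y d (suc i))
  cycle-Linked         []      (r ∷ _) zero    = r
  cycle-Linked         []      l       (suc i) = cycle-Linked [] l i
  cycle-Linked         (z ∷ d) (r ∷ _) zero    = r
  cycle-Linked {y = y} (z ∷ d) (r ∷ l) (suc i) = cycle-Linked (d ++ y ∷ []) rotated i
    where
    rotated : Linked R (z ∷ (d ++ y ∷ []) ++ z ∷ [])
    rotated = subst (λ ws → Linked R (z ∷ ws)) (sym (++-assoc d (y ∷ []) (z ∷ [])))
      (Linked-replaceSuffix (z ∷ d) refl l (r ∷ [-]))

  prepend-Linked : ∀ xs {s} → Linked R (xs ++ s 0 ∷ []) → (∀ i → R (s i) (s (suc i))) →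
    ∀ i → R (prepend xs s i) (prepend xs s (suc i))
  prepend-Linked []           _       rs i       = rs i
  prepend-Linked (x ∷ [])     (r ∷ _) rs zero    = r
  prepend-Linked (x ∷ [])     _       rs (suc i) = rs i
  prepend-Linked (x ∷ y ∷ xs) (r ∷ _) rs zero    = r
  prepend-Linked (x ∷ y ∷ xs) (_ ∷ l) rs (suc i) = prepend-Linked (y ∷ xs) l rs i

  lasso-Linked : ∀ c {y d e} → Linked R (c ++ y ∷ d ++ y ∷ e) →
    ∀ i → R (lasso c y d i) (lasso c y d (suc i))
  lasso-Linked c {y} {d} {e} l = prepend-Linked c stem (cycle-Linked d loop)
    where
    stem : Linked R (c ++ y ∷ [])
    stem = Linked-++⁻ˡ (c ++ y ∷ []) (subst (Linked R) (sym (++-assoc c (y ∷ []) _)) l)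
    loop : Linked R (y ∷ d ++ y ∷ [])
    loop = Linked-++⁻ˡ (y ∷ d ++ y ∷ [])
      (subst (λ ws → Linked R (y ∷ ws)) (sym (++-assoc d (y ∷ []) e)) (Linked-++⁻ʳ c l))

module _ {P : Pred B ℓ} where

  cycle-All : ∀ {y} d → All P (y ∷ d) → ∀ i → P (cycle y d i)
  cycle-All []      (py ∷ _)       zero    = py
  cycle-All []      ps             (suc i) = cycle-All [] ps i
  cycle-All (z ∷ d) (py ∷ _)       zero    = py
  cycle-All (z ∷ d) (py ∷ pz ∷ pd) (suc i) = cycle-All (d ++ _ ∷ []) (pz ∷ All.++⁺ pd (py ∷ [])) i

  prepend-All : ∀ {xs s} → All P xs → (∀ i → P (s i)) → ∀ i → P (prepend xs s i)
  prepend-All []        ps i       = ps i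
  prepend-All (px ∷ _)  ps zero    = px
  prepend-All (_ ∷ pxs) ps (suc i) = prepend-All pxs ps i

  prepend-Any : ∀ {xs s} → Any P xs → ∃[ i ] P (prepend xs s i)
  prepend-Any (here px) = zero , px
  prepend-Any (there p) with prepend-Any p
  ... | i , pi = suc i , pi

  lasso-All : ∀ c {y d e} → All P (c ++ y ∷ d ++ y ∷ e) → ∀ i → P (lasso c y d i)
  lasso-All c {y} {d} ps = prepend-All (All.++⁻ˡ c ps) (cycle-All d (All.++⁻ˡ (y ∷ d) (All.++⁻ʳ c ps)))

PumpedRepeats : {A : Set} → LabeledGraph A → Set
PumpedRepeats {A} G = Σ (List A) λ R → Σ (List A) λ S → R ≢ [] × S ≢ [] ×
  (∀ (m : ℕ) → m ≥ 1 → Repeated G ((R ^^ m) ++ S))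

module _ {A : Set} (G : LabeledGraph A) where
  open LabeledGraph G

  Edge : Rel (V G) _
  Edge u v = edge u v ≡ true

  isWalk⇒Linked : ∀ {p} → IsWalk G p → Linked Edge p
  isWalk⇒Linked []      = []
  isWalk⇒Linked [ v ]   = [-]
  isWalk⇒Linked (e ∷ w) = e ∷ isWalk⇒Linked w

  Linked⇒isWalk : ∀ {p} → Linked Edge p → IsWalk G p
  Linked⇒isWalk []            = []
  Linked⇒isWalk ([-] {x = v}) = [ v ]
  Linked⇒isWalk (e ∷ l)       = e ∷ Linked⇒isWalk l

  Pair : Set
  Pair = V G × V G

  SameLabel : Pred Pair _
  SameLabel = uncurry (λ u v → label u ≡ label v)

  Distinct : Pred Pair _
  Distinct = uncurry _≢_

  PairEdge : Rel Pair _
  PairEdge = (Edge on proj₁) ∩ (Edge on proj₂)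

  word : List Pair → List A
  word ps = spell G (map proj₁ ps)

  length-word : ∀ ps → length (word ps) ≡ length ps
  length-word ps = trans (length-map label (map proj₁ ps)) (length-map proj₁ ps)

  pairs-of-repeated : ∀ {s} → Repeated G s →
    ∃[ ps ] All SameLabel ps × Linked PairEdge ps × Any Distinct ps × word ps ≡ s
  pairs-of-repeated (p , q , wp , wq , sp , sq , p≢q) =
    zip p q , All-zip sameLabels , Linked-zip sameLabels (isWalk⇒Linked wp) (isWalk⇒Linked wq)
      , Any-zip-≢ _≟_ p≢q sameLabels , trans (cong (spell G) (map-proj₁-zip sameLabels)) sp
    where
    sameLabels : Pointwise (λ u v → label u ≡ label v) p q
    sameLabels = Pointwise.map⁻ label label (≡⇒Pointwise-≡ (trans sp (sym sq)))

  repeated-word : ∀ {ps} → All SameLabel ps → Linked PairEdge ps → Any Distinct ps →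
    Repeated G (word ps)
  repeated-word {ps} same steps distinct =
    map proj₁ ps , map proj₂ ps ,
    Linked⇒isWalk (Linked.map⁺ (proj₁ (Linked.unzip steps))) ,
    Linked⇒isWalk (Linked.map⁺ (proj₂ (Linked.unzip steps))) ,
    refl , spell₂≡word , Any-≢⇒map-≢ distinct
    where
    spell₂≡word : spell G (map proj₂ ps) ≡ word ps
    spell₂≡word = begin
      map label (map proj₂ ps)      ≡⟨ map-∘ ps ⟨
      map (λ x → label (proj₂ x)) ps ≡⟨ map-cong-local same ⟨
      map (λ x → label (proj₁ x)) ps ≡⟨ map-∘ ps ⟩
      word ps                       ∎
      where open ≡-Reasoning

  repeated-pumped : ∀ {y d e} → All SameLabel (y ∷ d ++ y ∷ e) →
    Linked PairEdge (y ∷ d ++ y ∷ e) → Any Distinct (y ∷ d ++ y ∷ e) →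
    ∀ m → m ≥ 1 → Repeated G ((word (y ∷ d) ^^ m) ++ word (y ∷ e))
  repeated-pumped {y} {d} {e} same steps distinct (suc m) _ =
    subst (Repeated G) word-pumped
      (repeated-word (All-^^-++ (y ∷ d) same (suc m)) (Linked-^^-++ steps (suc m))
        (Any-^^-++ (y ∷ d) distinct m))
    where
    word-pumped : word (((y ∷ d) ^^ suc m) ++ y ∷ e) ≡ (word (y ∷ d) ^^ suc m) ++ word (y ∷ e)
    word-pumped = trans (cong (spell G) (map-^^-++ proj₁ (y ∷ d) (suc m) (y ∷ e)))
                        (map-^^-++ label (map proj₁ (y ∷ d)) (suc m) (map proj₁ (y ∷ e)))

  infRepeated-lasso : ∀ c {y d e} → All SameLabel (c ++ y ∷ d ++ y ∷ e) →
    Linked PairEdge (c ++ y ∷ d ++ y ∷ e) → Any Distinct c →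
    InfRepeated G (λ i → label (proj₁ (lasso c y d i)))
  infRepeated-lasso c {y} {d} same steps distinct =
    (λ i → proj₁ (lasso c y d i)) , (λ i → proj₂ (lasso c y d i)) ,
    (λ i → proj₁ (lasso-Linked c steps i)) , (λ i → proj₂ (lasso-Linked c steps i)) ,
    (λ i → refl) , (λ i → sym (lasso-All c same i)) , prepend-Any distinct

  pumped-of-long-repeated : NoInfRepeated G → ∀ {s} → size * size < length s → Repeated G s →
    PumpedRepeats G
  pumped-of-long-repeated noInf long rep with pairs-of-repeated rep
  ... | ps , same , steps , distinct , refl
    with pigeonhole-split combine-injective {ps} (subst (_ <_) (length-word ps) long)
  ... | c , y , d , e , refl with Any.++⁻ c distinct
  ... | inj₁ inStem = ⊥-elim (noInf _ (infRepeated-lasso c same steps inStem))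
  ... | inj₂ inLoop = word (y ∷ d) , word (y ∷ e) , (λ ()) , (λ ()) ,
    repeated-pumped (All.++⁻ʳ c same) (Linked-++⁻ʳ c steps) inLoop

  unbounded-of-pumped : PumpedRepeats G → UnboundedRepeated G
  unbounded-of-pumped (R , S , R≢[] , _ , rep) n =
    (R ^^ suc n) ++ S ,
    ≤-trans (≤-length-^^ (suc n) R≢[]) (subst (_ ≤_) (sym (length-++ (R ^^ suc n))) (m≤m+n _ _)) ,
    rep (suc n) (s≤s z≤n)

  pumped-of-unbounded : NoInfRepeated G → UnboundedRepeated G → PumpedRepeats G
  pumped-of-unbounded noInf unbounded with unbounded (size * size)
  ... | s , long , rep = pumped-of-long-repeated noInf long rep

lemma2 : {A : Set} (G : LabeledGraph A) → NoInfRepeated G →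
    (UnboundedRepeated G ⇔
      Σ (List A) λ R → Σ (List A) λ S → R ≢ [] × S ≢ [] ×
        (∀ (m : ℕ) → m ≥ 1 → Repeated G ((R ^^ m) ++ S)))
lemma2 G noInf = mk⇔ (pumped-of-unbounded G noInf) (unbounded-of-pumped G)
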